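{- Let $G$ be a nilpotent finite group, let $N = G' = [G,G]$, and assume $N$ is cyclic. Let $S=\{\sigma_1,\dots,\sigma_\ell\}\subseteq G$ be such that $\overline{S}$ is a minimal generating set of $\overline{G}=G/N$ and $\ell=\#S=\#\overline{S}\ge 2$. If either $\alpha_\ell^1$ or $\alpha_\ell^{2+}$ holds, then there is a hamiltonian cycle in $\mathrm{Cay}(\overline{G};\overline{S})$ whose voltage generates $N$.
   Context: Notation: $g\mapsto\overline g$ is the natural map $G\to\overline G=G/N$. $\mathrm{Cay}(\overline G;\overline S)$ has vertex set $\overline G$ and edges $\overline g$—$\overline{g s}$ for $s\in S$. For $1\le k\le \ell$ let $S_k=\{\sigma_i: i\le k\}$, $G_k=\langle S_k\rangle N$, and $G_k'=[G_k,G_k]$. For a set $X$ and integer $r$, $X^r=\{x^r:x\in X\}$ and $X^{\pm1}=X\cup X^{ -1}$; for a cyclic group $H$, $H^2$ is the subgroup of squares. An oriented hamiltonian cycle in $\mathrm{Cay}(\overline{G_k};\overline{S_k})$ is given by a starting vertex $\overline g$ and a sequence $(s_1,\dots,s_n)$ of elements of $S_k^{\pm1}$, $n=|\overline{G_k}|$, such that the walk $\overline g,\overline{gs_1},\overline{gs_1s_2},\dots,\overline{gs_1\cdots s_n}$ visits every vertex of $\overline{G_k}$ exactly once before returning to $\overline g$; its voltage is $s_1s_2\cdots s_n\in N$. Such a cycle covers $S_k^{\pm1}$ if for every $s\in S_k$ there are indices $i\ne j$ with $s_i=s$ and $s_j=s^{ -1}$. $\mathcal V_k$ denotes the set of voltages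 of oriented hamiltonian cycles in $\mathrm{Cay}(\overline{G_k};\overline{S_k})$ that cover $S_k^{\pm1}$. For $2\le k\le\ell$ and $\epsilon\in\{1,2\}$, condition $\alpha_k^\epsilon$ states: there exists $h_k\in N$ such that for every $x\in N$ the set $(\mathcal V_k\cap (G_k')^\epsilon h_k)\,x$ contains an element generating a subgroup of $N$ that contains $(G_k')^\epsilon$. Condition $\alpha_k^{2+}$ states: $\alpha_k^2$ holds (with some $h_k$) and $\langle h_k,(G_k')^2\rangle\supseteq G_k'$. -}

module Defs where

open import Level using (0ℓ)
open import Algebra.Bundles using (Group)
open import Data.Nat using (ℕ; zero; suc; _<_; _≤_)
import Data.Fin
open import Data.Fin using (Fin; toℕ)
open import Data.List using (List)
open import Data.List.Relation.Unary.Any using (Any)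
open import Data.Product using (Σ; ∃; _×_; _,_)
open import Data.Sum using (_⊎_)
open import Data.Unit using (⊤)
open import Relation.Nullary using (¬_)
open import Relation.Binary.PropositionalEquality using (_≡_)
open import Relation.Unary using (Pred)

module GroupDefs (G : Group 0ℓ 0ℓ) where
  open Group G

  _⊆_ : Pred Carrier 0ℓ → Pred Carrier 0ℓ → Set
  P ⊆ Q = ∀ {x} → P x → Q x

  All : Pred Carrier 0ℓ
  All _ = ⊤

  Finite : Set
  Finite = Σ (List Carrier) λ xs → ∀ x → Any (x ≈_) xs

  data ⟨_⟩ (P : Pred Carrier 0ℓ) : Pred Carrier 0ℓ where
    gen  : ∀ {x} → P x → ⟨ P ⟩ x
    unit : ⟨ P ⟩ ε
    mul  : ∀ {x y} → ⟨ P ⟩ x → ⟨ P ⟩ y → ⟨ P ⟩ (x ∙ y)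
    inv  : ∀ {x} → ⟨ P ⟩ x → ⟨ P ⟩ (x ⁻¹)
    resp : ∀ {x y} → x ≈ y → ⟨ P ⟩ x → ⟨ P ⟩ y

  ⟨_⟩₁ : Carrier → Pred Carrier 0ℓ
  ⟨ c ⟩₁ = ⟨ (λ x → x ≈ c) ⟩

  [_,_] : Carrier → Carrier → Carrier
  [ a , b ] = ((a ⁻¹ ∙ b ⁻¹) ∙ a) ∙ b

  Comm : Pred Carrier 0ℓ → Pred Carrier 0ℓ → Pred Carrier 0ℓ
  Comm A B = ⟨ (λ x → Σ Carrier λ a → Σ Carrier λ b → A a × B b × x ≈ [ a , b ]) ⟩

  Derived : Pred Carrier 0ℓ → Pred Carrier 0ℓ
  Derived H = Comm H H

  N : Pred Carrier 0ℓ
  N = Derived All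

  γ : ℕ → Pred Carrier 0ℓ
  γ zero = All
  γ (suc i) = Comm (γ i) All

  Nilpotent : Set
  Nilpotent = Σ ℕ λ c → ∀ x → γ c x → x ≈ ε

  Cyclic : Pred Carrier 0ℓ → Set
  Cyclic H = Σ Carrier λ c → H c × (H ⊆ ⟨ c ⟩₁)

  -- congruence modulo N (equality in G/N)
  _≡N_ : Carrier → Carrier → Set
  x ≡N y = N (x ⁻¹ ∙ y)

  Pow : Pred Carrier 0ℓ → ℕ → Pred Carrier 0ℓ
  Pow H 2 x = Σ Carrier λ y → H y × x ≈ y ∙ y
  Pow H _ = H

  Coset : Pred Carrier 0ℓ → Carrier → Pred Carrier 0ℓ
  Coset H h x = Σ Carrier λ y → H y × x ≈ y ∙ h

  prod : (n : ℕ) → (Fin n → Carrier) → Carrier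
  prod zero s = ε
  prod (suc n) s = s Data.Fin.zero ∙ prod n (λ i → s (Data.Fin.suc i))

  pre : (n : ℕ) → (Fin n → Carrier) → ℕ → Carrier
  pre n s zero = ε
  pre zero s (suc m) = ε
  pre (suc n) s (suc m) = s Data.Fin.zero ∙ pre n (λ i → s (Data.Fin.suc i)) m


  module Gens {ℓ : ℕ} (σ : Fin ℓ → Carrier) where

    -- S_k = {σ_i : i ≤ k}  (1-indexed; Fin index i stands for σ_{i+1})
    S : ℕ → Pred Carrier 0ℓ
    S k x = Σ (Fin ℓ) λ i → toℕ i < k × x ≈ σ i

    S± : ℕ → Pred Carrier 0ℓ
    S± k x = Σ (Fin ℓ) λ i → toℕ i < k × (x ≈ σ i ⊎ x ≈ σ i ⁻¹)

    Gk : ℕ → Pred Carrier 0ℓ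
    Gk k x = Σ Carrier λ a → Σ Carrier λ m → ⟨ S k ⟩ a × N m × x ≈ a ∙ m

    Gk' : ℕ → Pred Carrier 0ℓ
    Gk' k = Derived (Gk k)

    -- an oriented hamiltonian cycle in Cay(Ḡ_k; S̄_k): starting vertex g (a
    -- representative in G_k) and steps s_0..s_{n-1} in S_k^{±1}; the vertices
    -- g·s_0⋯s_{a-1} (a < n) are pairwise distinct mod N, cover Ḡ_k, and the walk
    -- returns to ḡ (equivalently the voltage lies in N).
    record HamCycleOn (V : Pred Carrier 0ℓ) (k : ℕ) : Set where
      field
        n      : ℕ
        g      : Carrier
        g∈     : V g
        s      : Fin n → Carrier
        steps  : ∀ j → S± k (s j)
        distinct : ∀ a b → a < n → b < n → (g ∙ pre n s a) ≡N (g ∙ pre n s b) → a ≡ b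
        covers : ∀ x → V x → Σ ℕ λ a → a < n × (g ∙ pre n s a) ≡N x
        closes : N (prod n s)

      voltage : Carrier
      voltage = prod n s

      CoversS± : Set
      CoversS± = ∀ (i : Fin ℓ) → toℕ i < k →
        Σ (Fin n) λ a → Σ (Fin n) λ b → ¬ (a ≡ b) × s a ≈ σ i × s b ≈ σ i ⁻¹

    HamCycle : ℕ → Set
    HamCycle k = HamCycleOn (Gk k) k

    𝒱 : ℕ → Pred Carrier 0ℓ
    𝒱 k v = Σ (HamCycle k) λ C → HamCycleOn.CoversS± C × v ≈ HamCycleOn.voltage C

    αWith : ℕ → ℕ → Carrier → Set
    αWith k e h = N h × (∀ x → N x →
      Σ Carrier λ v → 𝒱 k v × Coset (Pow (Gk' k) e) h v ×
        (Pow (Gk' k) e ⊆ ⟨ v ∙ x ⟩₁))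

    α : ℕ → ℕ → Set
    α k e = Σ Carrier λ h → αWith k e h

    α2+ : ℕ → Set
    α2+ k = Σ Carrier λ h → αWith k 2 h ×
      (Gk' k ⊆ ⟨ (λ x → x ≈ h ⊎ Pow (Gk' k) 2 x) ⟩)

    GeneratesMod : Pred (Fin ℓ) 0ℓ → Set
    GeneratesMod T = ∀ x → Σ Carrier λ a → ⟨ (λ y → Σ (Fin ℓ) λ i → T i × y ≈ σ i) ⟩ a × a ≡N x

    MinimalGenMod : Set₁
    MinimalGenMod = GeneratesMod (λ _ → ⊤) ×
      (∀ (T : Pred (Fin ℓ) 0ℓ) → GeneratesMod T → ∀ i → T i)

    -- #S̄ = ℓ : the σ_i are pairwise distinct modulo N
    DistinctMod : Set
    DistinctMod = ∀ i j → σ i ≡N σ j → i ≡ j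

module Submission where

-- At the last stage k = ℓ the subgroup G_ℓ = ⟨S⟩N is all of G,
-- because S̄ generates Ḡ = G/N; hence G_ℓ' = [G,G] = N.  So it suffices to
-- find a voltage v ∈ 𝒱_ℓ with G_ℓ' ⊆ ⟨v⟩, and to view the hamiltonian cycle
-- of Cay(Ḡ_ℓ; S̄_ℓ) carrying v as a hamiltonian cycle of Cay(Ḡ; S̄).
--   * Under α_k^1 (applied with x = 1) there is v ∈ 𝒱_k with G_k' ⊆ ⟨v⟩.
--   * Under α_k^{2+} there is v ∈ 𝒱_k ∩ (G_k')² h_k with (G_k')² ⊆ ⟨v⟩.
--     Writing v = y h_k with y ∈ (G_k')² ⊆ ⟨v⟩ gives h_k = y⁻¹ v ∈ ⟨v⟩, so
--     G_k' ⊆ ⟨h_k, (G_k')²⟩ ⊆ ⟨v⟩.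

open import Defs
open import Level using (0ℓ)
open import Algebra.Bundles using (Group)
import Algebra.Properties.Group as GroupProperties
open import Data.Nat using (ℕ; _≤_)
open import Data.Fin using (Fin)
open import Data.Fin.Properties using (toℕ<n)
open import Data.Product using (Σ; _×_; _,_)
open import Data.Sum using (_⊎_; inj₁; inj₂)
open import Data.Unit using (tt)
open import Relation.Unary using (Pred)

module Subgroups (G : Group 0ℓ 0ℓ) where
  open Group G
  open GroupDefs G
  open GroupProperties G using (y≈x\\z; \\-leftDividesˡ)

  ⟨⟩-least : ∀ {P Q : Pred Carrier 0ℓ} → P ⊆ ⟨ Q ⟩ → ⟨ P ⟩ ⊆ ⟨ Q ⟩
  ⟨⟩-least P⊆Q (gen p)    = P⊆Q p
  ⟨⟩-least P⊆Q unit       = unit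
  ⟨⟩-least P⊆Q (mul x y)  = mul (⟨⟩-least P⊆Q x) (⟨⟩-least P⊆Q y)
  ⟨⟩-least P⊆Q (inv x)    = inv (⟨⟩-least P⊆Q x)
  ⟨⟩-least P⊆Q (resp e x) = resp e (⟨⟩-least P⊆Q x)

  ⟨⟩-mono : ∀ {P Q : Pred Carrier 0ℓ} → P ⊆ Q → ⟨ P ⟩ ⊆ ⟨ Q ⟩
  ⟨⟩-mono P⊆Q = ⟨⟩-least (λ p → gen (P⊆Q p))

  ⟨⟩₁-resp : ∀ {a b} → a ≈ b → ⟨ a ⟩₁ ⊆ ⟨ b ⟩₁
  ⟨⟩₁-resp a≈b = ⟨⟩-mono (λ x≈a → trans x≈a a≈b)

  Comm-mono : ∀ {A A′ B B′ : Pred Carrier 0ℓ} → A ⊆ A′ → B ⊆ B′ → Comm A B ⊆ Comm A′ B′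
  Comm-mono A⊆A′ B⊆B′ = ⟨⟩-mono λ { (a , b , a∈A , b∈B , e) → a , b , A⊆A′ a∈A , B⊆B′ b∈B , e }

  -- If v ∈ H h and H ⊆ ⟨v⟩ then h ∈ ⟨v⟩ (as h = y⁻¹ v with y ∈ H).
  coset-rep∈ : ∀ {H : Pred Carrier 0ℓ} {h v} → Coset H h v → H ⊆ ⟨ v ⟩₁ → ⟨ v ⟩₁ h
  coset-rep∈ {h = h} {v} (y , y∈H , v≈yh) H⊆⟨v⟩ =
    resp (sym (y≈x\\z y h v (sym v≈yh))) (mul (inv (H⊆⟨v⟩ y∈H)) (gen refl))

  module LastStage {ℓ : ℕ} (σ : Fin ℓ → Carrier) where
    open Gens σ

    -- If any subfamily of σ generates G modulo N, then G_ℓ = ⟨S⟩N is all of G: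
    -- x = a (a⁻¹ x) with a ∈ ⟨S⟩ and a⁻¹ x ∈ N.
    Gℓ-full : ∀ {T} → GeneratesMod T → All ⊆ Gk ℓ
    Gℓ-full gens {x} _ with gens x
    ... | a , a∈⟨T⟩ , a⁻¹x∈N =
      a , a ⁻¹ ∙ x , ⟨⟩-mono (λ { (i , _ , e) → i , toℕ<n i , e }) a∈⟨T⟩ , a⁻¹x∈N ,
      sym (\\-leftDividesˡ a x)

    N⊆Gℓ' : All ⊆ Gk ℓ → N ⊆ Gk' ℓ
    N⊆Gℓ' full = Comm-mono full full

    onWhole : ∀ {k} → All ⊆ Gk k → HamCycle k → HamCycleOn All k
    onWhole full C = record
      { n = n ; g = g ; g∈ = tt ; s = s ; steps = steps ; distinct = distinct
      ; covers = λ x _ → covers x (full tt) ; closes = closes }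
      where open HamCycleOn C

    GoodVoltage : ℕ → Set
    GoodVoltage k = Σ Carrier λ v → 𝒱 k v × Gk' k ⊆ ⟨ v ⟩₁

    -- α_k^1, applied with x = 1, yields a good voltage.
    α¹⇒good : ∀ {k} → α k 1 → GoodVoltage k
    α¹⇒good (h , _ , α-at) with α-at ε unit
    ... | v , v∈𝒱 , _ , Gk'⊆⟨v1⟩ = v , v∈𝒱 , λ z → ⟨⟩₁-resp (identityʳ v) (Gk'⊆⟨v1⟩ z)

    -- α_k^{2+} yields a good voltage: ⟨v⟩ contains (G_k')² and h_k, which
    -- together generate G_k'.
    α²⁺⇒good : ∀ {k} → α2+ k → GoodVoltage k
    α²⁺⇒good {k} (h , (_ , α-at) , Gk'⊆⟨h,sq⟩) with α-at ε unit
    ... | v , v∈𝒱 , v∈sq·h , sq⊆⟨v1⟩ = v , v∈𝒱 , λ z → ⟨⟩-least gens∈⟨v⟩ (Gk'⊆⟨h,sq⟩ z)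
      where
      sq⊆⟨v⟩ : Pow (Gk' k) 2 ⊆ ⟨ v ⟩₁
      sq⊆⟨v⟩ y = ⟨⟩₁-resp (identityʳ v) (sq⊆⟨v1⟩ y)

      gens∈⟨v⟩ : ∀ {z} → z ≈ h ⊎ Pow (Gk' k) 2 z → ⟨ v ⟩₁ z
      gens∈⟨v⟩ (inj₁ z≈h) = resp (sym z≈h) (coset-rep∈ v∈sq·h sq⊆⟨v⟩)
      gens∈⟨v⟩ (inj₂ z∈sq) = sq⊆⟨v⟩ z∈sq

    good⇒cycle : All ⊆ Gk ℓ → GoodVoltage ℓ →
      Σ (HamCycleOn All ℓ) λ C → N ⊆ ⟨ HamCycleOn.voltage C ⟩₁
    good⇒cycle full (v , (C , _ , v≈voltage) , Gℓ'⊆⟨v⟩) =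
      onWhole full C , λ x∈N → ⟨⟩₁-resp v≈voltage (Gℓ'⊆⟨v⟩ (N⊆Gℓ' full x∈N))

open Subgroups using (module LastStage)

-- Lemma 2.5.
lemma2p5 : (G : Group 0ℓ 0ℓ) → let open Group G in let open GroupDefs G in
    Finite → Nilpotent → Cyclic N →
    (ℓ : ℕ) (σ : Fin ℓ → Carrier) → let open Gens σ in
    2 ≤ ℓ → MinimalGenMod → DistinctMod →
    (α ℓ 1 ⊎ α2+ ℓ) →
    Σ (HamCycleOn All ℓ) λ C → N ⊆ ⟨ HamCycleOn.voltage C ⟩₁
lemma2p5 G _ _ _ ℓ σ _ (generates , _) _ αℓ = good⇒cycle (Gℓ-full generates) (good αℓ)
  where
  open GroupDefs.Gens G σ using (α; α2+)
  open LastStage G σ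

  good : α ℓ 1 ⊎ α2+ ℓ → GoodVoltage ℓ
  good (inj₁ α¹)  = α¹⇒good α¹
  good (inj₂ α²⁺) = α²⁺⇒good α²⁺
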